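{- For every finite path $p$ in $G_n$, the relation $\le$ on $Q_p$ is a partial order (in particular, it is antisymmetric: $x_i\le x_j$ and $x_j\le x_i$ imply $i=j$).
   Context: $[k]=\{1,\dots,k\}$. For distinct reals $y_1,\dots,y_k$, $\mathrm{Order}(y_1,\dots,y_k)$ is the unique $\sigma\in S_k$ with $y_i<y_j$ iff $\sigma(i)<\sigma(j)$. $\rho,\rho':S_{n+1}\to S_n$: $\rho(\sigma)=\mathrm{Order}(\sigma(1),\dots,\sigma(n))$, $\rho'(\sigma)=\mathrm{Order}(\sigma(2),\dots,\sigma(n+1))$. The permutation digraph $G_n$ has vertex set $S_n$ and edge set $S_{n+1}$, edge $e$ directed from $\rho(e)$ to $\rho'(e)$. A path of length $\ell$ is $(v_0,e_1,v_1,\dots,e_\ell,v_\ell)$ with $e_i$ directed from $v_{i-1}$ to $v_i$. For such a path $p$, $Q_p=\{x_1,\dots,x_{\ell+n}\}$ (with $x_i$ distinct symbols) and $\le$ is the reflexive-transitive closure of the relations: $x_{a+c}\le x_{a+d}$ whenever $0\le a\le\ell$, $c,d\in[n]$, $v_a(c)\le v_a(d)$; and $x_{a-1+c}\le x_{a-1+d}$ whenever $1\le a\le\ell$, $c,d\in[n+1]$, $e_a(c)\le e_a(d)$. -}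

module Defs where

open import Data.Nat using (ℕ; suc; _+_)
open import Data.Fin using (Fin; toℕ; inject₁) renaming (suc to fsuc; _<_ to _<ᶠ_; _≤_ to _≤ᶠ_)
open import Data.Fin.Permutation using (Permutation′; _⟨$⟩ʳ_)
open import Data.Product using (_×_)
open import Relation.Binary.PropositionalEquality using (_≡_)
open import Relation.Binary.Construct.Closure.ReflexiveTransitive using (Star)

-- S_k is represented by 'Permutation′ k' (bijections Fin k → Fin k); positions
-- and values are 0-based.

IsOrder : ∀ {k} → (Fin k → Fin (suc k)) → Permutation′ k → Set
IsOrder y σ = ∀ i j → ((y i <ᶠ y j) → (σ ⟨$⟩ʳ i <ᶠ σ ⟨$⟩ʳ j))
                    × ((σ ⟨$⟩ʳ i <ᶠ σ ⟨$⟩ʳ j) → (y i <ᶠ y j))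

-- ρ(e) = v   :  v = Order(e(1),...,e(n))
ρ≡ : ∀ {n} → Permutation′ (suc n) → Permutation′ n → Set
ρ≡ e v = IsOrder (λ i → e ⟨$⟩ʳ inject₁ i) v

-- ρ'(e) = v  :  v = Order(e(2),...,e(n+1))
ρ'≡ : ∀ {n} → Permutation′ (suc n) → Permutation′ n → Set
ρ'≡ e v = IsOrder (λ i → e ⟨$⟩ʳ fsuc i) v

-- A path of length ℓ in G_n: vertices v_0..v_ℓ, edges e_1..e_ℓ (0-based here:
-- edge a goes from vertex a to vertex a+1).
record Path (n ℓ : ℕ) : Set where
  field
    vtx  : Fin (suc ℓ) → Permutation′ n
    edg  : Fin ℓ → Permutation′ (suc n)
    src  : ∀ a → ρ≡  (edg a) (vtx (inject₁ a))
    tgt  : ∀ a → ρ'≡ (edg a) (vtx (fsuc a))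
open Path public

-- Generating relations on Q_p = {x_0,...,x_{ℓ+n-1}} (0-based; x_i ↔ i : Fin (ℓ+n)).
data Gen {n ℓ : ℕ} (p : Path n ℓ) : Fin (ℓ + n) → Fin (ℓ + n) → Set where
  vrel : (a : Fin (suc ℓ)) (c d : Fin n) (i j : Fin (ℓ + n)) →
         toℕ i ≡ toℕ a + toℕ c → toℕ j ≡ toℕ a + toℕ d →
         (vtx p a ⟨$⟩ʳ c) ≤ᶠ (vtx p a ⟨$⟩ʳ d) → Gen p i j
  erel : (a : Fin ℓ) (c d : Fin (suc n)) (i j : Fin (ℓ + n)) →
         toℕ i ≡ toℕ a + toℕ c → toℕ j ≡ toℕ a + toℕ d →
         (edg p a ⟨$⟩ʳ c) ≤ᶠ (edg p a ⟨$⟩ʳ d) → Gen p i j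

_≤Q[_]_ : ∀ {n ℓ} → Fin (ℓ + n) → Path n ℓ → Fin (ℓ + n) → Set
i ≤Q[ p ] j = Star (Gen p) i j

-- Label the positions 0, …, ℓ+n-1 by natural numbers so that the window of
-- length n (resp. n+1) starting at a is ordered like the vertex v_a (resp. the
-- edge e_a). Such a labelling is built along the path: e_a is ordered like v_a on
-- its first n entries, so only the new position a+n needs a label, and it fits
-- strictly between the labels of the entries that e_a puts below and above its
-- last one; v_{a+1} is then the pattern of the last n entries of e_a. A
-- generating relation x_i ≤ x_j then either has i = j (permutations are
-- injective) or strictly increases the label, so its closure is antisymmetric.
module Submission where

open import Defs
open import Data.Nat using (ℕ)
open import Relation.Binary.PropositionalEquality using (_≡_)
open import Relation.Binary.Structures using (IsPartialOrder)
open import Relation.Binary.Construct.Closure.ReflexiveTransitive using (Star)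

open import Level using (Level)
open import Function using (_∘_; _⇔_; mk⇔; Equivalence)
open import Function.Bundles using (Injection)
open import Function.Properties.Inverse using (↔⇒↣)
open import Data.Nat using (suc; _+_; _*_; _<_; _≤_; z≤n; s≤s; s≤s⁻¹; _≟_; _<?_)
open import Data.Nat.Properties
  using (<-trans; <-irrefl; <-asym; ≤-refl; ≤-trans; ≤-reflexive; <-≤-trans;
         +-suc; +-monoʳ-<; +-monoˡ-≤; *-suc; *-monoʳ-<; *-monoʳ-≤; m≤n⇒m<n∨m≡n)
open import Data.Fin using (Fin; toℕ; inject₁; fromℕ; fromℕ<)
  renaming (zero to fzero; suc to fsuc; _<_ to _<ᶠ_; _≤_ to _≤ᶠ_)
open import Data.Fin.Properties using (toℕ<n; toℕ-injective; toℕ-inject₁; toℕ-fromℕ; fromℕ<-toℕ)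
  renaming (_<?_ to _<ᶠ?_; <-trans to <ᶠ-trans; <-irrefl to <ᶠ-irrefl)
open import Data.Fin.Induction using (<-weakInduction)
open import Data.Fin.Relation.Unary.Top using (view; ‵fromℕ; ‵inject₁)
open import Data.Fin.Permutation using (Permutation′; _⟨$⟩ʳ_)
open import Data.List using (tabulate)
open import Data.List.Extrema.Nat using (max; v≤max⁺; max≤v⁺)
import Data.List.Relation.Unary.All.Properties as All
import Data.List.Relation.Unary.Any.Properties as Any
open import Data.Product using (Σ; _×_; _,_; proj₁; proj₂)
open import Data.Sum using (_⊎_; inj₁; inj₂)
open import Data.Empty using (⊥-elim)
open import Relation.Nullary using (yes; no; contradiction)
open import Relation.Binary.Core using (Rel; _⇒_)
open import Relation.Binary.PropositionalEquality using (refl; sym; trans; cong; subst; subst₂)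
open import Relation.Binary.Construct.Closure.ReflexiveTransitive using (fold)
open import Relation.Binary.Construct.Closure.ReflexiveTransitive.Properties using (isPreorder)

private
  variable
    m m′ : ℕ

module _ {a : Level} {A : Set a} (rank : A → ℕ) where

  RankIncreasing : Rel A _
  RankIncreasing x y = x ≡ y ⊎ rank x < rank y

  Star-rankIncreasing : ∀ {r} {R : Rel A r} → R ⇒ RankIncreasing → Star R ⇒ RankIncreasing
  Star-rankIncreasing step = fold RankIncreasing (λ r q → compose (step r) q) (inj₁ refl)
    where
    compose : ∀ {x y z} → RankIncreasing x y → RankIncreasing y z → RankIncreasing x z
    compose (inj₁ refl) q           = q
    compose (inj₂ x<y)  (inj₁ refl) = inj₂ x<y
    compose (inj₂ x<y)  (inj₂ y<z)  = inj₂ (<-trans x<y y<z)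

  rankIncreasing⇒isPartialOrder : ∀ {r} {R : Rel A r} → R ⇒ RankIncreasing → IsPartialOrder _≡_ (Star R)
  rankIncreasing⇒isPartialOrder {R = R} step = record
    { isPreorder = isPreorder R
    ; antisym    = λ xy yx → antisym (Star-rankIncreasing step xy) (Star-rankIncreasing step yx)
    }
    where
    antisym : ∀ {x y} → RankIncreasing x y → RankIncreasing y x → x ≡ y
    antisym (inj₁ x≡y) _           = x≡y
    antisym (inj₂ _)   (inj₁ y≡x)  = sym y≡x
    antisym (inj₂ x<y) (inj₂ y<x)  = ⊥-elim (<-asym x<y y<x)

record Realizes (g : ℕ → ℕ) (a : ℕ) (w : Fin m → Fin m′) : Set where
  constructor realizes
  field
    ordered : ∀ c d → w c <ᶠ w d → g (a + toℕ c) < g (a + toℕ d)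

open Realizes

Refines : ℕ → (ℕ → ℕ) → (ℕ → ℕ) → Set
Refines b g h = ∀ {x y} → x < b → y < b → g x < g y → h x < h y

Realizes-refine : ∀ {g h a b} {w : Fin m → Fin m′} →
                  a + m ≤ b → Refines b g h → Realizes g a w → Realizes h a w
Realizes-refine {a = a} a+m≤b g⊑h g-realizes = realizes λ c d wc<wd →
  g⊑h (inWindow c) (inWindow d) (ordered g-realizes c d wc<wd)
  where
  inWindow : ∀ c → a + toℕ c < _
  inWindow c = <-≤-trans (+-monoʳ-< a (toℕ<n c)) a+m≤b

Realizes-tail : ∀ {g a} {w : Fin (suc m) → Fin m′} → Realizes g a w → Realizes g (suc a) (w ∘ fsuc)
Realizes-tail {g = g} {a} g-realizes = realizes λ c d wc<wd →
  subst₂ (λ x y → g x < g y) (+-suc a (toℕ c)) (+-suc a (toℕ d))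
         (ordered g-realizes (fsuc c) (fsuc d) wc<wd)

Realizes-IsOrder : ∀ {g a} {y : Fin m → Fin (suc m)} (σ : Permutation′ m) →
                   IsOrder y σ → Realizes g a y ⇔ Realizes g a (σ ⟨$⟩ʳ_)
Realizes-IsOrder σ σ≡Order[y] = mk⇔
  (λ g-realizes → realizes λ c d σc<σd → ordered g-realizes c d (proj₂ (σ≡Order[y] c d) σc<σd))
  (λ g-realizes → realizes λ c d yc<yd → ordered g-realizes c d (proj₁ (σ≡Order[y] c d) yc<yd))

-- Ties in the pattern of a permutation only occur between equal positions.
Realizes⇒rankIncreasing : ∀ {g a N} (π : Permutation′ m) → Realizes g a (π ⟨$⟩ʳ_) →
                          ∀ {c d} {i j : Fin N} → toℕ i ≡ a + toℕ c → toℕ j ≡ a + toℕ d →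
                          π ⟨$⟩ʳ c ≤ᶠ π ⟨$⟩ʳ d → RankIncreasing (g ∘ toℕ) i j
Realizes⇒rankIncreasing {g = g} π g-realizes {c} {d} i≡a+c j≡a+d πc≤πd
  with m≤n⇒m<n∨m≡n πc≤πd
... | inj₁ πc<πd =
  inj₂ (subst₂ (λ x y → g x < g y) (sym i≡a+c) (sym j≡a+d) (ordered g-realizes c d πc<πd))
... | inj₂ πc≡πd with Injection.injective (↔⇒↣ π) (toℕ-injective πc≡πd)
...   | refl = inj₁ (toℕ-injective (trans i≡a+c (sym j≡a+d)))

-- Positions beyond the pattern get the junk label 0.
patternLabels : (Fin m → Fin m′) → ℕ → ℕ
patternLabels {m} w x with x <? m
... | yes x<m = toℕ (w (fromℕ< x<m))
... | no _    = 0

patternLabels-realizes : (w : Fin m → Fin m′) → Realizes (patternLabels w) 0 w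
patternLabels-realizes {m} w = realizes λ c d wc<wd →
  subst₂ _<_ (sym (patternLabels-toℕ c)) (sym (patternLabels-toℕ d)) wc<wd
  where
  patternLabels-toℕ : ∀ c → patternLabels w (toℕ c) ≡ toℕ (w c)
  patternLabels-toℕ c with toℕ c <? m
  ... | yes c<m = cong (toℕ ∘ w) (fromℕ<-toℕ c c<m)
  ... | no c≮m  = contradiction (toℕ<n c) c≮m

-- If g realizes the first n entries of w in the window at k, then relabelling
-- extends this to all of w without changing the order of the earlier labels.
module Extension {n} (g : ℕ → ℕ) (k : ℕ) (w : Fin (suc n) → Fin m)
                 (realizes-init : Realizes g k (w ∘ inject₁)) where

  top : Fin m
  top = w (fromℕ n)

  boundBelowTop : Fin n → ℕ
  boundBelowTop c with w (inject₁ c) <ᶠ? top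
  ... | yes _ = suc (g (k + toℕ c))
  ... | no _  = 0

  gap : ℕ
  gap = max 0 (tabulate boundBelowTop)

  below-gap : ∀ c → w (inject₁ c) <ᶠ top → g (k + toℕ c) < gap
  below-gap c wc<top = v≤max⁺ 0 (tabulate boundBelowTop) (inj₂ (Any.tabulate⁺ c bound))
    where
    bound : g (k + toℕ c) < boundBelowTop c
    bound with w (inject₁ c) <ᶠ? top
    ... | yes _     = ≤-refl
    ... | no wc≮top = contradiction wc<top wc≮top

  gap-above : ∀ d → top <ᶠ w (inject₁ d) → gap ≤ g (k + toℕ d)
  gap-above d top<wd = max≤v⁺ z≤n (All.tabulate⁺ bound)
    where
    bound : ∀ c → boundBelowTop c ≤ g (k + toℕ d)
    bound c with w (inject₁ c) <ᶠ? top
    ... | yes wc<top = ordered realizes-init c d (<ᶠ-trans wc<top top<wd)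
    ... | no _       = z≤n

  -- Old labels become odd and the new one even, so that 2·gap fits strictly
  -- between the labels of the window positions below and above the top entry.
  label : ℕ → ℕ
  label x with x ≟ k + n
  ... | yes _ = 2 * gap
  ... | no _  = suc (2 * g x)

  label-new : label (k + toℕ (fromℕ n)) ≡ 2 * gap
  label-new rewrite toℕ-fromℕ n with k + n ≟ k + n
  ... | yes _ = refl
  ... | no k+n≢k+n = contradiction refl k+n≢k+n

  label-old : ∀ {x} → x < k + n → label x ≡ suc (2 * g x)
  label-old {x} x<k+n with x ≟ k + n
  ... | yes x≡k+n = ⊥-elim (<-irrefl x≡k+n x<k+n)
  ... | no _      = refl

  label-refines : Refines (k + n) g label
  label-refines x<k+n y<k+n gx<gy rewrite label-old x<k+n | label-old y<k+n =
    s≤s (*-monoʳ-< 2 gx<gy)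

  label-inject₁ : ∀ c → label (k + toℕ (inject₁ c)) ≡ suc (2 * g (k + toℕ c))
  label-inject₁ c rewrite toℕ-inject₁ c = label-old (+-monoʳ-< k (toℕ<n c))

  label-ordered : ∀ c d → w c <ᶠ w d → label (k + toℕ c) < label (k + toℕ d)
  label-ordered c d wc<wd with view c | view d
  ... | ‵fromℕ      | ‵fromℕ      = ⊥-elim (<ᶠ-irrefl refl wc<wd)
  ... | ‵fromℕ      | ‵inject₁ d′ rewrite label-new | label-inject₁ d′ =
    s≤s (*-monoʳ-≤ 2 (gap-above d′ wc<wd))
  ... | ‵inject₁ c′ | ‵fromℕ      rewrite label-new | label-inject₁ c′ =
    ≤-trans (≤-reflexive (sym (*-suc 2 _))) (*-monoʳ-≤ 2 (below-gap c′ wc<wd))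
  ... | ‵inject₁ c′ | ‵inject₁ d′ rewrite label-inject₁ c′ | label-inject₁ d′ =
    s≤s (*-monoʳ-< 2 (ordered realizes-init c′ d′ wc<wd))

  label-realizes : Realizes label k w
  label-realizes = realizes label-ordered

module _ {n ℓ} (p : Path n ℓ) where

  RealizesPrefix : ℕ → (ℕ → ℕ) → Set
  RealizesPrefix k g = (∀ a → toℕ a ≤ k → Realizes g (toℕ a) (vtx p a ⟨$⟩ʳ_))
                     × (∀ a → toℕ a < k → Realizes g (toℕ a) (edg p a ⟨$⟩ʳ_))

  RealizesPrefix-start : RealizesPrefix 0 (patternLabels (vtx p fzero ⟨$⟩ʳ_))
  RealizesPrefix-start = vertices , λ _ ()
    where
    vertices : ∀ a → toℕ a ≤ 0 →
               Realizes (patternLabels (vtx p fzero ⟨$⟩ʳ_)) (toℕ a) (vtx p a ⟨$⟩ʳ_)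
    vertices fzero z≤n = patternLabels-realizes (vtx p fzero ⟨$⟩ʳ_)

  RealizesPrefix-step : ∀ a {g} → RealizesPrefix (toℕ a) g →
                        Σ (ℕ → ℕ) (RealizesPrefix (suc (toℕ a)))
  RealizesPrefix-step a {g} (vertices , edges) = label , vertices′ , edges′
    where
    realizes-init : Realizes g (toℕ a) ((edg p a ⟨$⟩ʳ_) ∘ inject₁)
    realizes-init = subst (λ b → Realizes g b ((edg p a ⟨$⟩ʳ_) ∘ inject₁)) (toℕ-inject₁ a)
      (Equivalence.from (Realizes-IsOrder (vtx p (inject₁ a)) (src p a))
                        (vertices (inject₁ a) (≤-reflexive (toℕ-inject₁ a))))

    open Extension g (toℕ a) (edg p a ⟨$⟩ʳ_) realizes-init

    vertices′ : ∀ b → toℕ b ≤ suc (toℕ a) → Realizes label (toℕ b) (vtx p b ⟨$⟩ʳ_)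
    vertices′ b b≤1+a with m≤n⇒m<n∨m≡n b≤1+a
    ... | inj₁ (s≤s b≤a) = Realizes-refine (+-monoˡ-≤ n b≤a) label-refines (vertices b b≤a)
    ... | inj₂ b≡1+a with toℕ-injective {i = b} {j = fsuc a} b≡1+a
    ...   | refl = Equivalence.to (Realizes-IsOrder (vtx p (fsuc a)) (tgt p a))
                                  (Realizes-tail label-realizes)

    edges′ : ∀ b → toℕ b < suc (toℕ a) → Realizes label (toℕ b) (edg p b ⟨$⟩ʳ_)
    edges′ b b<1+a with m≤n⇒m<n∨m≡n (s≤s⁻¹ b<1+a)
    ... | inj₁ b<a = Realizes-refine (≤-trans (≤-reflexive (+-suc (toℕ b) n)) (+-monoˡ-≤ n b<a))
                                     label-refines (edges b b<a)
    ... | inj₂ b≡a with toℕ-injective {i = b} {j = a} b≡a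
    ...   | refl = label-realizes

  realization : Σ (ℕ → ℕ) (RealizesPrefix ℓ)
  realization = subst (λ k → Σ (ℕ → ℕ) (RealizesPrefix k)) (toℕ-fromℕ ℓ)
                      (<-weakInduction Realizable start step (fromℕ ℓ))
    where
    Realizable : Fin (suc ℓ) → Set
    Realizable i = Σ (ℕ → ℕ) (RealizesPrefix (toℕ i))

    start : Realizable fzero
    start = patternLabels (vtx p fzero ⟨$⟩ʳ_) , RealizesPrefix-start

    step : ∀ a → Realizable (inject₁ a) → Realizable (fsuc a)
    step a (g , prefix) =
      RealizesPrefix-step a (subst (λ k → RealizesPrefix k g) (toℕ-inject₁ a) prefix)

  Gen-rankIncreasing : Gen p ⇒ RankIncreasing (proj₁ realization ∘ toℕ)
  Gen-rankIncreasing (vrel a c d i j i≡a+c j≡a+d σc≤σd) =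
    Realizes⇒rankIncreasing (vtx p a) (proj₁ (proj₂ realization) a (s≤s⁻¹ (toℕ<n a)))
                            i≡a+c j≡a+d σc≤σd
  Gen-rankIncreasing (erel a c d i j i≡a+c j≡a+d ec≤ed) =
    Realizes⇒rankIncreasing (edg p a) (proj₂ (proj₂ realization) a (toℕ<n a))
                            i≡a+c j≡a+d ec≤ed

corollary3p3 : (n ℓ : ℕ) (p : Path n ℓ) → IsPartialOrder _≡_ (Star (Gen p))
corollary3p3 n ℓ p = rankIncreasing⇒isPartialOrder _ (Gen-rankIncreasing p)
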